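{- Let $m \geq 3$ be an integer, let $\mathcal{A}$ be a finite set with a strict linear order $<$, and let $\mathcal{B}$ be a weakly $(m-1)$-wise balanced design over $\mathcal{A}$. Suppose $|\mathcal{A}| \leq k|\mathcal{B}|$ for some real $k > 0$. Then $\frac{|\mathcal{A}| + |\mathcal{B}|}{k + 1} \leq \alpha(\Gamma_{\mathcal{B}, m})$.
   Context: For an integer $r \geq 2$ and a set $\mathcal{A}$ (whose elements are called points), a weakly $r$-wise balanced design over $\mathcal{A}$ is a family $\mathcal{B}$ of subsets of $\mathcal{A}$ (called blocks) such that: (1) any $r$ pairwise distinct points are contained together in at most one block; (2) every point lies in at least one block; (3) every block is non-empty. Given $m \geq 3$, a weakly $(m-1)$-wise balanced design $\mathcal{B}$ over $\mathcal{A}$, and a strict linear order $<$ on $\mathcal{A}$, the graph $\Gamma_{\mathcal{B}, m}$ has as vertices all incidence pairs $(x, B)$ with $B \in \mathcal{B}$ and $x \in B$; two vertices $(x, B_1)$ and $(y, B_2)$ are adjacent iff $x < y$, $B_1 \neq B_2$, and $x \in B_2$. $\alpha$ denotes the independence number.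
   Formalization: The parameter k ranges over the positive rationals rather than the positive reals. -}

module Defs where

open import Data.Nat using (ℕ; _∸_)
open import Data.Fin using (Fin; _<_)
open import Data.Fin.Subset using (Subset; _∈_)
open import Data.Product using (Σ; ∃; _×_; _,_)
open import Data.List using (List; length)
open import Data.List.Relation.Unary.All using (All)
open import Data.List.Relation.Unary.Unique.Propositional using (Unique)
open import Data.List.Membership.Propositional renaming (_∈_ to _∈ₗ_)
open import Relation.Binary.PropositionalEquality using (_≡_; _≢_)
open import Relation.Nullary using (¬_)
open import Function.Definitions using (Injective)

-- Point set 𝒜 = Fin n with its natural strict linear order _<_.
-- A family of blocks ℬ with b blocks is an injective map Fin b → Subset n
-- (injective: ℬ is a set of subsets, |ℬ| = b).

record WeaklyBalanced (r n b : ℕ) (ℬ : Fin b → Subset n) : Set where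
  field
    atMostOne : (xs : Fin r → Fin n) → Injective _≡_ _≡_ xs →
                (i j : Fin b) → (∀ t → xs t ∈ ℬ i) → (∀ t → xs t ∈ ℬ j) → i ≡ j
    covers    : (x : Fin n) → ∃ λ i → x ∈ ℬ i
    nonEmpty  : (i : Fin b) → ∃ λ x → x ∈ ℬ i

IsVertex : ∀ {n b} → (Fin b → Subset n) → Fin n × Fin b → Set
IsVertex ℬ (x , i) = x ∈ ℬ i

-- (x , i) ~ (y , j) iff x < y, i ≠ j and x ∈ ℬ j  (edge of Γ when this holds
-- in either orientation).
Adj : ∀ {n b} → (Fin b → Subset n) → Fin n × Fin b → Fin n × Fin b → Set
Adj ℬ (x , i) (y , j) = (x < y) × (i ≢ j) × (x ∈ ℬ j)

record IndependentSet {n b} (ℬ : Fin b → Subset n) (S : List (Fin n × Fin b)) : Set where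
  field
    vertices : All (IsVertex ℬ) S
    distinct : Unique S
    noEdges  : ∀ {u v} → u ∈ₗ S → v ∈ₗ S → ¬ Adj ℬ u v

record IsIndependenceNumber {n b} (ℬ : Fin b → Subset n) (a : ℕ) : Set where
  field
    attained : Σ (List (Fin n × Fin b)) λ S → IndependentSet ℬ S × length S ≡ a
    maximal  : ∀ S → IndependentSet ℬ S → length S Data.Nat.≤ a

{-# OPTIONS --safe #-}
-- Choosing in every block B its least point x_B gives |ℬ| incidences (x_B , B)
-- that are pairwise non-adjacent: an edge (x_B , B) ~ (x_C , C) would put
-- x_B ∈ C with x_B < x_C, against the minimality of x_C. Hence α ≥ |ℬ|, and
-- |𝒜| + |ℬ| ≤ k|ℬ| + |ℬ| = (k + 1)|ℬ| ≤ (k + 1)α.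
module Submission where

open import Defs
open import Data.Nat using (ℕ; _∸_; _≤_)
open import Data.Integer using (+_)
open import Data.Rational using (ℚ; _/_; 0ℚ; 1ℚ; _+_; _*_) renaming (_≤_ to _≤ℚ_; _<_ to _<ℚ_)
open import Data.Fin using (Fin)
open import Data.Fin.Subset using (Subset)
open import Function.Definitions using (Injective)
open import Relation.Binary.PropositionalEquality using (_≡_)

import Data.Integer as ℤ
import Data.Integer.Properties as ℤ
import Data.Rational as ℚ
import Data.Rational.Properties as ℚ
import Data.Nat.Coprimality as Coprimality
open import Data.Fin using (zero; suc; _<_)
open import Data.Fin.Subset using (_∈_; inside; outside)
open import Data.Vec.Base using (_∷_; here; there)
open import Data.Nat using (s≤s)
open import Data.Product using (∃; _×_; _,_; proj₁; proj₂)
open import Data.List using (List; tabulate)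
open import Data.List.Properties using (length-tabulate)
import Data.List.Relation.Unary.All.Properties as All
import Data.List.Relation.Unary.Unique.Propositional.Properties as Unique
open import Data.List.Membership.Propositional renaming (_∈_ to _∈ₗ_)
open import Data.List.Membership.Propositional.Properties using (∈-tabulate⁻)
open import Relation.Binary.PropositionalEquality using (refl; cong; sym; subst; subst₂)
open import Relation.Nullary using (¬_)

IsLeast : ∀ {n} → Subset n → Fin n → Set
IsLeast p x = x ∈ p × (∀ {y} → y ∈ p → ¬ y < x)

least : ∀ {n} {p : Subset n} {x} → x ∈ p → ∃ (IsLeast p)
least {p = inside  ∷ p} _ = zero , here , λ { {zero} _ () }
least {p = outside ∷ p} {suc x} (there x∈p) with least x∈p
... | y , y∈p , y-least = suc y , there y∈p , λ { {suc z} (there z∈p) (s≤s z<y) → y-least z∈p z<y }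

module LeastIncidences {n b} (ℬ : Fin b → Subset n) (nonEmpty : ∀ i → ∃ λ x → x ∈ ℬ i) where

  leastPoint : Fin b → Fin n
  leastPoint i = proj₁ (least (proj₂ (nonEmpty i)))

  leastPoint-isLeast : ∀ i → IsLeast (ℬ i) (leastPoint i)
  leastPoint-isLeast i = proj₂ (least (proj₂ (nonEmpty i)))

  incidence : Fin b → Fin n × Fin b
  incidence i = leastPoint i , i

  leastIncidences : List (Fin n × Fin b)
  leastIncidences = tabulate incidence

  leastIncidences-independent : IndependentSet ℬ leastIncidences
  leastIncidences-independent = record
    { vertices = All.tabulate⁺ (λ i → proj₁ (leastPoint-isLeast i))
    ; distinct = Unique.tabulate⁺ (cong proj₂)
    ; noEdges  = noEdges
    }
    where
    noEdges : ∀ {u v} → u ∈ₗ leastIncidences → v ∈ₗ leastIncidences → ¬ Adj ℬ u v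
    noEdges u∈ v∈ _ with ∈-tabulate⁻ {f = incidence} u∈ | ∈-tabulate⁻ {f = incidence} v∈
    noEdges _ _ (x<y , _ , x∈ℬj) | i , refl | j , refl = proj₂ (leastPoint-isLeast j) x∈ℬj x<y

  blocks≤independenceNumber : ∀ {α} → IsIndependenceNumber ℬ α → b ≤ α
  blocks≤independenceNumber isα =
    subst (_≤ _) (length-tabulate incidence)
      (IsIndependenceNumber.maximal isα leastIncidences leastIncidences-independent)

-- + a / 1 reduces to normalize a 1, which is stuck on gcd a 1 for variable a.
+/1-mono-≤ : ∀ {a c} → a ≤ c → + a / 1 ≤ℚ + c / 1
+/1-mono-≤ {a} {c} a≤c
  rewrite ℚ.normalize-coprime {a} {0} (Coprimality.sym (Coprimality.1-coprimeTo a))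
        | ℚ.normalize-coprime {c} {0} (Coprimality.sym (Coprimality.1-coprimeTo c))
  = ℚ.*≤* (subst₂ ℤ._≤_ (sym (ℤ.*-identityʳ (+ a))) (sym (ℤ.*-identityʳ (+ c))) (ℤ.+≤+ a≤c))

p≤k*q∧q≤r⇒p+q≤[k+1]*r : ∀ k .{{_ : ℚ.NonNegative k}} {p q r} →
                        p ≤ℚ k * q → q ≤ℚ r → p + q ≤ℚ (k + 1ℚ) * r
p≤k*q∧q≤r⇒p+q≤[k+1]*r k {p} {q} {r} p≤kq q≤r = begin
  p + q             ≤⟨ ℚ.+-monoˡ-≤ q p≤kq ⟩
  k * q + q         ≡⟨ cong (λ s → k * q + s) (sym (ℚ.*-identityˡ q)) ⟩
  k * q + 1ℚ * q    ≡⟨ sym (ℚ.*-distribʳ-+ q k 1ℚ) ⟩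
  (k + 1ℚ) * q      ≤⟨ ℚ.*-monoˡ-≤-nonNeg (k + 1ℚ) {{ℚ.nonNeg+nonNeg⇒nonNeg k 1ℚ}} q≤r ⟩
  (k + 1ℚ) * r      ∎
  where open ℚ.≤-Reasoning

corollary2p7 : (m n b : ℕ) → 3 ≤ m → (ℬ : Fin b → Subset n) → Injective _≡_ _≡_ ℬ →
    WeaklyBalanced (m ∸ 1) n b ℬ → (k : ℚ) → 0ℚ <ℚ k →
    (+ n / 1) ≤ℚ k * (+ b / 1) →
    (α : ℕ) → IsIndependenceNumber ℬ α →
    (+ n / 1) + (+ b / 1) ≤ℚ (k + 1ℚ) * (+ α / 1)
corollary2p7 m n b _ ℬ _ design k 0<k n≤kb α isα =
  p≤k*q∧q≤r⇒p+q≤[k+1]*r k {{ℚ.pos⇒nonNeg k {{ℚ.positive 0<k}}}} n≤kb (+/1-mono-≤ b≤α)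
  where
  b≤α : b ≤ α
  b≤α = LeastIncidences.blocks≤independenceNumber ℬ (WeaklyBalanced.nonEmpty design) isα
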